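{- Let $n \ge 4$ and let $f_{n,i}$ denote the number of $i$-dimensional faces of the Whitehouse complex $\Delta_n$. Then for $-1 \le i \le n-4$, $$f_{n,i} = (i+2)\, f_{n-1,i} + (n+i-1)\, f_{n-1,i-1},$$ and $f_{n,-1}=1$.
   Context: For $m \ge 3$, the Whitehouse complex $\Delta_m$ is the simplicial complex with vertex set $V_m = \{S \subseteq \{2,\ldots,m\} : 2 \le |S| \le m-2\}$, in which $F \subseteq V_m$ is a face iff any two $S,T \in F$ satisfy $S \subseteq T$, $T \subseteq S$, or $S \cap T = \emptyset$. A face $F$ has dimension $|F|-1$; the empty face is the unique face of dimension $-1$. By convention $f_{m,j}=0$ if $\Delta_m$ has no face of dimension $j$ (e.g. $j<-1$ or $j > m-4$). -}

module Defs where

open import Data.Bool using (Bool; true; false; _∧_; _∨_)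
open import Data.Nat using (ℕ; zero; suc; _∸_; _≤ᵇ_; _≡ᵇ_)
open import Data.Integer using (ℤ; +_; -[1+_])
open import Data.List using (List; []; _∷_; _++_; map; filter; length)
open import Data.Vec using (Vec; []; _∷_)
open import Data.Fin.Subset using (Subset; _∩_; ∣_∣)
open import Data.Fin.Subset.Properties using (_⊆?_)
open import Relation.Nullary.Decidable using (⌊_⌋)

allSubsets : (k : ℕ) → List (Subset k)
allSubsets zero    = [] ∷ []
allSubsets (suc k) = map (true ∷_) (allSubsets k) ++ map (false ∷_) (allSubsets k)

sublists : {A : Set} → List A → List (List A)
sublists []       = [] ∷ []
sublists (x ∷ xs) = map (x ∷_) (sublists xs) ++ sublists xs

-- Ground set {2,…,m} is encoded as Fin (m ∸ 1): index t stands for t + 2.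
Ground : ℕ → ℕ
Ground m = m ∸ 1

isVertex : (m : ℕ) → Subset (Ground m) → Bool
isVertex m S = (2 ≤ᵇ ∣ S ∣) ∧ (∣ S ∣ ≤ᵇ (m ∸ 2))

V : (m : ℕ) → List (Subset (Ground m))
V m = filter (λ S → Data.Bool._≟_ (isVertex m S) true) (allSubsets (Ground m))

compatible : {k : ℕ} → Subset k → Subset k → Bool
compatible S T = ⌊ S ⊆? T ⌋ ∨ ⌊ T ⊆? S ⌋ ∨ (∣ S ∩ T ∣ ≡ᵇ 0)

pairwise : {k : ℕ} → List (Subset k) → Bool

allCompat : {k : ℕ} → Subset k → List (Subset k) → Bool
allCompat S []      = true
allCompat S (T ∷ F) = compatible S T ∧ allCompat S F

pairwise []       = true
pairwise (S ∷ F)  = allCompat S F ∧ pairwise F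

faces : (m : ℕ) → List (List (Subset (Ground m)))
faces m = filter (λ F → Data.Bool._≟_ (pairwise F) true) (sublists (V m))

countFaces : (m k : ℕ) → ℕ
countFaces m k = length (filter (λ F → Data.Nat._≟_ (length F) k) (faces m))

f : ℕ → ℤ → ℕ
f m (+ j)         = countFaces m (suc j)
f m -[1+ zero ]   = countFaces m 0
f m -[1+ suc _ ]  = 0

{-# OPTIONS --safe #-}
module Submission where

-- Single out the point 2 of the ground set {2,…,n} of Δ_n. In a face, the sets containing 2
-- pairwise intersect, so they form a chain; deleting 2 from them, all sets of the face live on
-- the ground set of Δ_{n-1}. Let c be the smallest set of the chain (the whole ground set if the
-- chain is empty) and z the family of those sets that are vertices of Δ_{n-1}. Then z is a face
-- of Δ_{n-1}, and the face is recovered from z, c and whether a vertex was lost on the way: the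
-- sets of z containing c came from the chain, the others did not. For a face with i+1 vertices,
-- no vertex is lost iff c lies in z or is the whole set: i+2 choices of c next to a z with i+1
-- vertices. Otherwise exactly one is lost (c also occurs without 2, or c is a singleton, or the
-- chain is empty and the whole set occurs without 2): z has i vertices and c is one of them, one
-- of the n-2 singletons or the whole set, n+i-1 choices.

open import Defs
open import Data.Nat using (ℕ; _≤_)
open import Data.Nat using (_∸_)
open import Relation.Binary.PropositionalEquality using (_≡_)
open import Data.Product using (_×_)

module FaceCounting where

  open import Algebra.Properties.CommutativeSemigroup using (interchange)
  open import Data.Bool using (Bool; true; false; _∧_; _∨_; not; if_then_else_)
  import Data.Bool as Bool
  open import Data.Bool.ListAction using (all)
  open import Data.Bool.Properties using (T-≡; ∧-zeroʳ; ∧-identityʳ; ∨-identityʳ; ∨-zeroʳ; ¬-not)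
  open import Data.Empty using (⊥-elim)
  open import Data.Fin.Subset using (Subset; _⊆_; _∩_; ⊤; ∣_∣; ⋂)
  open import Data.Fin.Subset.Properties
    using ( _⊆?_; ⊆-refl; ⊆-trans; ⊆-antisym; ⊆⊤; s⊆s; in⊆in; out⊆; drop-∷-⊆; ∣⊤∣≡n; ∣p∣≡n⇒p≡⊤
          ; p⊆q⇒∣p∣≤∣q∣; p∩q⊆p; p∩q⊆q; x∈p∩q⁺; ∩-comm; ∩-identityʳ)
  open import Data.List using (List; []; _∷_; _++_; map; filter; length; cartesianProduct)
  open import Data.List.Membership.Propositional using (_∈_)
  open import Data.List.Membership.Propositional.Properties using (∈-map⁺; ∈-map⁻; ∈-++⁺ˡ; ∈-++⁺ʳ; ∈-++⁻)
  open import Data.List.Properties using (length-++; length-map)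
  open import Data.List.Relation.Unary.Any using (here; there)
  open import Data.Nat using (ℕ; zero; suc; _+_; _*_; _∸_; _≤_; z≤n; s≤s; s≤s⁻¹; _≡ᵇ_; _≤ᵇ_)
  import Data.Nat as ℕ
  open import Data.Nat.Properties
    using ( +-assoc; +-comm; +-identityʳ; *-comm; *-identityˡ; *-identityʳ; *-distribˡ-+; +-commutativeSemigroup
          ; suc-injective; ≤-refl; ≤-trans; m≤n⇒m≤1+n; ≰⇒>; ≤∧≢⇒<; <⇒≱; n≤0⇒n≡0; ≡ᵇ⇒≡; ≡⇒≡ᵇ; ≤ᵇ⇒≤; ≤⇒≤ᵇ)
  open import Data.Nat.Tactic.RingSolver using (solve-∀)
  open import Data.Product using (Σ; _×_; _,_; proj₁; proj₂)
  open import Data.Product.Properties using (,-injectiveˡ; ,-injectiveʳ) renaming (≡-dec to ×-≡-dec)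
  open import Data.Sum using (_⊎_; inj₁; inj₂)
  open import Data.Vec using ([]; _∷_; here)
  open import Data.Vec.Properties using (≡-dec)
  open import Function using (_∘_)
  open import Function.Bundles using (Equivalence)
  open import Relation.Binary.Definitions using (DecidableEquality)
  open import Relation.Binary.PropositionalEquality
  open import Relation.Nullary using (Dec; does; yes; no; ¬_; contradiction)
  open import Relation.Nullary.Decidable using (dec-true; dec-false)
  open import Relation.Unary using (Pred; Decidable)

  private variable
    A B : Set
    k : ℕ

  sumBy : (A → ℕ) → List A → ℕ
  sumBy g []       = 0
  sumBy g (x ∷ xs) = g x + sumBy g xs

  bit : Bool → ℕ
  bit true  = 1
  bit false = 0

  count : (A → Bool) → List A → ℕ
  count p = sumBy (λ x → bit (p x))

  module _ {g h : A → ℕ} where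

    sumBy-cong : (∀ x → g x ≡ h x) → ∀ xs → sumBy g xs ≡ sumBy h xs
    sumBy-cong g≗h []       = refl
    sumBy-cong g≗h (x ∷ xs) = cong₂ _+_ (g≗h x) (sumBy-cong g≗h xs)

    sumBy-+ : ∀ xs → sumBy (λ x → g x + h x) xs ≡ sumBy g xs + sumBy h xs
    sumBy-+ []       = refl
    sumBy-+ (x ∷ xs) = trans (cong (g x + h x +_) (sumBy-+ xs))
      (interchange +-commutativeSemigroup (g x) (h x) (sumBy g xs) (sumBy h xs))

  module _ (g : A → ℕ) where

    sumBy-++ : ∀ xs ys → sumBy g (xs ++ ys) ≡ sumBy g xs + sumBy g ys
    sumBy-++ []       ys = refl
    sumBy-++ (x ∷ xs) ys = trans (cong (g x +_) (sumBy-++ xs ys)) (sym (+-assoc (g x) _ _))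

    sumBy-*ˡ : ∀ c xs → sumBy (λ x → c * g x) xs ≡ c * sumBy g xs
    sumBy-*ˡ c []       = sym (*-comm c 0)
    sumBy-*ˡ c (x ∷ xs) = trans (cong (c * g x +_) (sumBy-*ˡ c xs)) (sym (*-distribˡ-+ c (g x) _))

    sumBy-zero : (∀ x → g x ≡ 0) → ∀ xs → sumBy g xs ≡ 0
    sumBy-zero g≗0 []       = refl
    sumBy-zero g≗0 (x ∷ xs) = cong₂ _+_ (g≗0 x) (sumBy-zero g≗0 xs)

  sumBy-map : (g : B → ℕ) (f : A → B) → ∀ xs → sumBy g (map f xs) ≡ sumBy (λ x → g (f x)) xs
  sumBy-map g f []       = refl
  sumBy-map g f (x ∷ xs) = cong (g (f x) +_) (sumBy-map g f xs)

  sumBy-swap : (g : A → B → ℕ) → ∀ xs ys →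
    sumBy (λ x → sumBy (g x) ys) xs ≡ sumBy (λ y → sumBy (λ x → g x y) xs) ys
  sumBy-swap g []       ys = sym (sumBy-zero _ (λ _ → refl) ys)
  sumBy-swap g (x ∷ xs) ys = trans (cong (sumBy (g x) ys +_) (sumBy-swap g xs ys))
    (sym (sumBy-+ ys))

  sumBy-cartesianProduct : (g : A × B → ℕ) → ∀ xs ys →
    sumBy g (cartesianProduct xs ys) ≡ sumBy (λ x → sumBy (λ y → g (x , y)) ys) xs
  sumBy-cartesianProduct g []       ys = refl
  sumBy-cartesianProduct g (x ∷ xs) ys = trans (sumBy-++ g (map (x ,_) ys) _)
    (cong₂ _+_ (sumBy-map g (x ,_) ys) (sumBy-cartesianProduct g xs ys))

  sumBy-filter : ∀ {ℓ} {P : Pred A ℓ} (P? : Decidable P) (g : A → ℕ) → ∀ xs →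
    sumBy g (filter P? xs) ≡ sumBy (λ x → bit (does (P? x)) * g x) xs
  sumBy-filter P? g []       = refl
  sumBy-filter P? g (x ∷ xs) with does (P? x)
  ... | true  = cong₂ _+_ (sym (+-identityʳ (g x))) (sumBy-filter P? g xs)
  ... | false = sumBy-filter P? g xs

  length≡count : (xs : List A) → length xs ≡ count (λ _ → true) xs
  length≡count []       = refl
  length≡count (x ∷ xs) = cong suc (length≡count xs)

  bit-∧ : ∀ a b → bit (a ∧ b) ≡ bit a * bit b
  bit-∧ true  b = sym (+-identityʳ (bit b))
  bit-∧ false b = refl

  bit-∨ : ∀ a b → (a ≡ true → ¬ b ≡ true) → bit (a ∨ b) ≡ bit a + bit b
  bit-∨ true  true  a⇒¬b = contradiction refl (a⇒¬b refl)
  bit-∨ true  false _   = refl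
  bit-∨ false b     _   = refl

  bit-split : ∀ a b → bit (a ∧ b) + bit (a ∧ not b) ≡ bit a
  bit-split true  true  = refl
  bit-split true  false = refl
  bit-split false b     = refl

  count-cartesianProduct-∧ : (p : A → Bool) (g : A → B → Bool) (w : ℕ) (xs : List A) (ys : List B) →
    (∀ a → p a ≡ true → count (g a) ys ≡ w) →
    count (λ ab → p (proj₁ ab) ∧ g (proj₁ ab) (proj₂ ab)) (cartesianProduct xs ys) ≡ count p xs * w
  count-cartesianProduct-∧ p g w xs ys g-count = begin
    count (λ ab → p (proj₁ ab) ∧ g (proj₁ ab) (proj₂ ab)) (cartesianProduct xs ys)
      ≡⟨ sumBy-cartesianProduct _ xs ys ⟩
    sumBy (λ a → count (λ b → p a ∧ g a b) ys) xs
      ≡⟨ sumBy-cong row xs ⟩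
    sumBy (λ a → bit (p a) * w) xs
      ≡⟨ sumBy-cong (λ a → *-comm (bit (p a)) w) xs ⟩
    sumBy (λ a → w * bit (p a)) xs
      ≡⟨ sumBy-*ˡ _ w xs ⟩
    w * count p xs
      ≡⟨ *-comm w _ ⟩
    count p xs * w ∎
    where
    open ≡-Reasoning
    row : ∀ a → count (λ b → p a ∧ g a b) ys ≡ bit (p a) * w
    row a with p a in pa
    ... | true  = trans (g-count a pa) (sym (+-identityʳ w))
    ... | false = sumBy-zero _ (λ _ → refl) ys

  ∧-true⁻ : ∀ {a b} → a ∧ b ≡ true → a ≡ true × b ≡ true
  ∧-true⁻ {true} {true} _ = refl , refl

  ∨-true⁻ : ∀ {a b} → a ∨ b ≡ true → a ≡ true ⊎ b ≡ true
  ∨-true⁻ {true}  _   = inj₁ refl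
  ∨-true⁻ {false} b≡t = inj₂ b≡t

  not-true⁻ : ∀ {b} → not b ≡ true → b ≡ false
  not-true⁻ {false} _ = refl

  ≥2⇒≢ᵇ1 : ∀ {s} → 2 ≤ s → (s ≡ᵇ 1) ≡ false
  ≥2⇒≢ᵇ1 (s≤s (s≤s _)) = refl

  T⇒≡true : ∀ {b} → Bool.T b → b ≡ true
  T⇒≡true = Equivalence.to T-≡

  ≡true⇒T : ∀ {b} → b ≡ true → Bool.T b
  ≡true⇒T = Equivalence.from T-≡

  does⇒ : ∀ {P : Set} (d : Dec P) → does d ≡ true → P
  does⇒ (yes p) _ = p

  does⇒¬ : ∀ {P : Set} (d : Dec P) → does d ≡ false → ¬ P
  does⇒¬ (no ¬p) _ = ¬p

  record Enumerates (_≟_ : DecidableEquality A) (xs : List A) : Set where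
    field
      once : ∀ a → count (λ a′ → does (a′ ≟ a)) xs ≡ 1

  open Enumerates

  module _ {_≟_ : DecidableEquality A} {xs : List A} (enum : Enumerates _≟_ xs) where

    count-≟-∧ : ∀ a b → count (λ a′ → does (a′ ≟ a) ∧ b) xs ≡ bit b
    count-≟-∧ a b = begin
      count (λ a′ → does (a′ ≟ a) ∧ b) xs           ≡⟨ sumBy-cong (λ a′ → trans (bit-∧ _ b) (*-comm _ (bit b))) xs ⟩
      sumBy (λ a′ → bit b * bit (does (a′ ≟ a))) xs ≡⟨ sumBy-*ˡ _ (bit b) xs ⟩
      bit b * count (λ a′ → does (a′ ≟ a)) xs       ≡⟨ cong (bit b *_) (once enum a) ⟩
      bit b * 1                                     ≡⟨ *-identityʳ (bit b) ⟩
      bit b                                         ∎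
      where open ≡-Reasoning

  does-× : {a a′ : A} {b b′ : B} (d : Dec ((a′ , b′) ≡ (a , b))) →
           (da : Dec (a′ ≡ a)) (db : Dec (b′ ≡ b)) → does d ≡ does db ∧ does da
  does-× d (yes refl) (yes refl) = dec-true d refl
  does-× d (yes _)    (no b′≢b)  = dec-false d (b′≢b ∘ ,-injectiveʳ)
  does-× d (no a′≢a)  (yes _)    = dec-false d (a′≢a ∘ ,-injectiveˡ)
  does-× d (no a′≢a)  (no _)     = dec-false d (a′≢a ∘ ,-injectiveˡ)

  module _ {_≟A_ : DecidableEquality A} {_≟B_ : DecidableEquality B} {xs : List A} {ys : List B}
           (enumA : Enumerates _≟A_ xs) (enumB : Enumerates _≟B_ ys) where

    enumerates-cartesianProduct : Enumerates (×-≡-dec _≟A_ _≟B_) (cartesianProduct xs ys)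
    once enumerates-cartesianProduct (a , b) = begin
      count (λ p → does (×-≡-dec _≟A_ _≟B_ p (a , b))) (cartesianProduct xs ys)
        ≡⟨ sumBy-cartesianProduct _ xs ys ⟩
      sumBy (λ a′ → count (λ b′ → does (×-≡-dec _≟A_ _≟B_ (a′ , b′) (a , b))) ys) xs
        ≡⟨ sumBy-cong (λ a′ → sumBy-cong (λ b′ →
             cong bit (does-× (×-≡-dec _≟A_ _≟B_ _ _) (a′ ≟A a) (b′ ≟B b))) ys) xs ⟩
      sumBy (λ a′ → count (λ b′ → does (b′ ≟B b) ∧ does (a′ ≟A a)) ys) xs
        ≡⟨ sumBy-cong (λ a′ → count-≟-∧ enumB b _) xs ⟩
      count (λ a′ → does (a′ ≟A a)) xs
        ≡⟨ once enumA a ⟩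
      1 ∎
      where open ≡-Reasoning

    module _ (P : A → Bool) (Q : B → Bool) (φ : A → B) (ψ : B → A)
             (φ-Q : ∀ a → P a ≡ true → Q (φ a) ≡ true) (ψφ : ∀ a → P a ≡ true → ψ (φ a) ≡ a)
             (ψ-P : ∀ b → Q b ≡ true → P (ψ b) ≡ true) (φψ : ∀ b → Q b ≡ true → φ (ψ b) ≡ b) where

      private
        graph : A → B → ℕ
        graph a b = bit (P a ∧ does (b ≟B φ a))

        graph-row : ∀ a → sumBy (graph a) ys ≡ bit (P a)
        graph-row a with P a
        ... | true  = once enumB (φ a)
        ... | false = sumBy-zero _ (λ _ → refl) ys

        graph-column : ∀ b → sumBy (λ a → graph a b) xs ≡ bit (Q b)
        graph-column b with Q b in Qb
        ... | true  = trans (sumBy-cong (cong bit ∘ graph≡≟ψ) xs) (once enumA (ψ b))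
          where
          graph≡≟ψ : ∀ a → P a ∧ does (b ≟B φ a) ≡ does (a ≟A ψ b)
          graph≡≟ψ a with P a in Pa | b ≟B φ a
          ... | true  | yes refl = sym (dec-true (a ≟A _) (sym (ψφ a Pa)))
          ... | true  | no b≢φa  = sym (dec-false (a ≟A _) λ { refl → b≢φa (sym (φψ b Qb)) })
          ... | false | _        = sym (dec-false (a ≟A _) λ { refl → contradiction (trans (sym Pa) (ψ-P b Qb)) λ () })
        ... | false = sumBy-zero _ graph≡0 xs
          where
          graph≡0 : ∀ a → graph a b ≡ 0
          graph≡0 a with P a in Pa | b ≟B φ a
          ... | true  | yes refl = contradiction (trans (sym Qb) (φ-Q a Pa)) λ ()
          ... | true  | no _     = refl
          ... | false | _        = refl

      -- Both sides count the pairs (a , φ a) with P a.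
      count-bijection : count P xs ≡ count Q ys
      count-bijection = begin
        count P xs                                 ≡⟨ sumBy-cong (sym ∘ graph-row) xs ⟩
        sumBy (λ a → sumBy (graph a) ys) xs        ≡⟨ sumBy-swap graph xs ys ⟩
        sumBy (λ b → sumBy (λ a → graph a b) xs) ys ≡⟨ sumBy-cong graph-column ys ⟩
        count Q ys                                 ∎
        where open ≡-Reasoning

  Disjoint : Subset k → Subset k → Set
  Disjoint S T = ∣ S ∩ T ∣ ≡ 0

  Compatible : Subset k → Subset k → Set
  Compatible S T = S ⊆ T ⊎ T ⊆ S ⊎ Disjoint S T

  compatible⇒Compatible : (S T : Subset k) → compatible S T ≡ true → Compatible S T
  compatible⇒Compatible S T _ with S ⊆? T | T ⊆? S | ∣ S ∩ T ∣
  ... | yes S⊆T | _        | _    = inj₁ S⊆T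
  ... | no _    | yes T⊆S  | _    = inj₂ (inj₁ T⊆S)
  ... | no _    | no _     | zero = inj₂ (inj₂ refl)
  compatible⇒Compatible S T () | no _ | no _ | suc _

  Compatible⇒compatible : (S T : Subset k) → Compatible S T → compatible S T ≡ true
  Compatible⇒compatible S T S~T with S ⊆? T | T ⊆? S
  ... | yes _   | _       = refl
  ... | no _    | yes _   = refl
  ... | no S⊈T  | no T⊈S  with S~T
  ...   | inj₁ S⊆T        = ⊥-elim (S⊈T S⊆T)
  ...   | inj₂ (inj₁ T⊆S) = ⊥-elim (T⊈S T⊆S)
  ...   | inj₂ (inj₂ d)   = cong (_≡ᵇ 0) d

  Compatible-sym : {S T : Subset k} → Compatible S T → Compatible T S
  Compatible-sym (inj₁ S⊆T)        = inj₂ (inj₁ S⊆T)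
  Compatible-sym (inj₂ (inj₁ T⊆S)) = inj₁ T⊆S
  Compatible-sym {S = S} {T} (inj₂ (inj₂ d)) = inj₂ (inj₂ (trans (cong ∣_∣ (∩-comm T S)) d))

  Compatible-∷⁻ : ∀ a b {S T : Subset k} → Compatible (a ∷ S) (b ∷ T) → Compatible S T
  Compatible-∷⁻ a b (inj₁ aS⊆bT)        = inj₁ (drop-∷-⊆ aS⊆bT)
  Compatible-∷⁻ a b (inj₂ (inj₁ bT⊆aS)) = inj₂ (inj₁ (drop-∷-⊆ bT⊆aS))
  Compatible-∷⁻ true  true  (inj₂ (inj₂ ()))
  Compatible-∷⁻ true  false (inj₂ (inj₂ d)) = inj₂ (inj₂ d)
  Compatible-∷⁻ false b     (inj₂ (inj₂ d)) = inj₂ (inj₂ d)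

  ⊆-∩ : {c S T : Subset k} → c ⊆ S → c ⊆ T → c ⊆ S ∩ T
  ⊆-∩ c⊆S c⊆T x∈c = x∈p∩q⁺ (c⊆S x∈c , c⊆T x∈c)

  ⊆⇒∩≡ : {S T : Subset k} → S ⊆ T → S ∩ T ≡ S
  ⊆⇒∩≡ {S = S} {T} S⊆T = ⊆-antisym (p∩q⊆p S T) (⊆-∩ (λ x∈S → x∈S) S⊆T)

  common-⊆-Disjoint⇒∣∣≡0 : {c S T : Subset k} → c ⊆ S → c ⊆ T → Disjoint S T → ∣ c ∣ ≡ 0
  common-⊆-Disjoint⇒∣∣≡0 c⊆S c⊆T d = n≤0⇒n≡0 (subst (_ ≤_) d (p⊆q⇒∣p∣≤∣q∣ (⊆-∩ c⊆S c⊆T)))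

  p⊆q⇒∣q∣≤∣p∣⇒p≡q : {p q : Subset k} → p ⊆ q → ∣ q ∣ ≤ ∣ p ∣ → p ≡ q
  p⊆q⇒∣q∣≤∣p∣⇒p≡q {p = []}        {[]}        _   _ = refl
  p⊆q⇒∣q∣≤∣p∣⇒p≡q {p = false ∷ p} {false ∷ q} p⊆q q≤p       =
    cong (false ∷_) (p⊆q⇒∣q∣≤∣p∣⇒p≡q (drop-∷-⊆ p⊆q) q≤p)
  p⊆q⇒∣q∣≤∣p∣⇒p≡q {p = false ∷ p} {true ∷ q}  p⊆q q≤p       =
    contradiction q≤p (<⇒≱ (s≤s (p⊆q⇒∣p∣≤∣q∣ (drop-∷-⊆ p⊆q))))
  p⊆q⇒∣q∣≤∣p∣⇒p≡q {p = true ∷ p}  {false ∷ q} p⊆q _         = contradiction (p⊆q here) λ ()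
  p⊆q⇒∣q∣≤∣p∣⇒p≡q {p = true ∷ p}  {true ∷ q}  p⊆q (s≤s q≤p) =
    cong (true ∷_) (p⊆q⇒∣q∣≤∣p∣⇒p≡q (drop-∷-⊆ p⊆q) q≤p)

  ∣p∣≡1⇒p⊆q⊎Disjoint : (p q : Subset k) → ∣ p ∣ ≡ 1 → p ⊆ q ⊎ Disjoint p q
  ∣p∣≡1⇒p⊆q⊎Disjoint p q ∣p∣≡1 with ∣ p ∩ q ∣ in ∣p∩q∣≡
  ... | zero  = inj₂ refl
  ... | suc _ = inj₁ (subst (_⊆ q) p∩q≡p (p∩q⊆q p q))
    where
    p∩q≡p : p ∩ q ≡ p
    p∩q≡p = p⊆q⇒∣q∣≤∣p∣⇒p≡q (p∩q⊆p p q) (subst₂ _≤_ (sym ∣p∣≡1) (sym ∣p∩q∣≡) (s≤s z≤n))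

  ⋂-lowerBound : {S : Subset k} {L : List (Subset k)} → S ∈ L → ⋂ L ⊆ S
  ⋂-lowerBound {L = S ∷ L} (here refl) = p∩q⊆p S (⋂ L)
  ⋂-lowerBound {L = S ∷ L} (there T∈L) = ⊆-trans (p∩q⊆q S (⋂ L)) (⋂-lowerBound T∈L)

  ⋂-greatest : {c : Subset k} (L : List (Subset k)) → (∀ {S} → S ∈ L → c ⊆ S) → c ⊆ ⋂ L
  ⋂-greatest []      _     = ⊆⊤
  ⋂-greatest (S ∷ L) c⊆L = ⊆-∩ (c⊆L (here refl)) (⋂-greatest L (c⊆L ∘ there))

  ⋂-chain : (L : List (Subset k)) → (∀ {S T} → S ∈ L → T ∈ L → S ⊆ T ⊎ T ⊆ S) → ⋂ L ≡ ⊤ ⊎ ⋂ L ∈ L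
  ⋂-chain []      _     = inj₁ refl
  ⋂-chain (S ∷ L) chain with ⋂-chain L (λ S∈L T∈L → chain (there S∈L) (there T∈L))
  ... | inj₁ ⋂L≡⊤ = inj₂ (here (trans (cong (S ∩_) ⋂L≡⊤) (∩-identityʳ S)))
  ... | inj₂ ⋂L∈L with chain (here refl) (there ⋂L∈L)
  ...   | inj₁ S⊆⋂L = inj₂ (here (⊆⇒∩≡ S⊆⋂L))
  ...   | inj₂ ⋂L⊆S = inj₂ (there (subst (_∈ L) (sym (trans (∩-comm S (⋂ L)) (⊆⇒∩≡ ⋂L⊆S))) ⋂L∈L))

  ⋂-unique : {c : Subset k} (L : List (Subset k)) → (∀ {S} → S ∈ L → c ⊆ S) → c ≡ ⊤ ⊎ c ∈ L → ⋂ L ≡ c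
  ⋂-unique L c⊆L (inj₁ refl) = ⊆-antisym ⊆⊤ (⋂-greatest L c⊆L)
  ⋂-unique L c⊆L (inj₂ c∈L)  = ⊆-antisym (⋂-lowerBound c∈L) (⋂-greatest L c⊆L)

  _≟ₛ_ : DecidableEquality (Subset k)
  _≟ₛ_ = ≡-dec Bool._≟_

  -- A function Subset k → Bool tabulated as a binary trie, so that families of subsets have
  -- decidable equality and can be listed.
  Family : ℕ → Set
  Family zero    = Bool
  Family (suc k) = Family k × Family k

  member : Family k → Subset k → Bool
  member {zero}  b       []          = b
  member {suc k} (t , u) (true ∷ S)  = member t S
  member {suc k} (t , u) (false ∷ S) = member u S

  family : (Subset k → Bool) → Family k
  family {zero}  p = p []
  family {suc k} p = family (p ∘ (true ∷_)) , family (p ∘ (false ∷_))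

  member-family : (p : Subset k → Bool) (S : Subset k) → member (family p) S ≡ p S
  member-family {zero}  p []          = refl
  member-family {suc k} p (true ∷ S)  = member-family (p ∘ (true ∷_)) S
  member-family {suc k} p (false ∷ S) = member-family (p ∘ (false ∷_)) S

  family-unique : (p : Subset k → Bool) (t : Family k) → (∀ S → p S ≡ member t S) → family p ≡ t
  family-unique {zero}  p t       p≗t = p≗t []
  family-unique {suc k} p (t , u) p≗t =
    cong₂ _,_ (family-unique _ t (p≗t ∘ (true ∷_))) (family-unique _ u (p≗t ∘ (false ∷_)))

  members : Family k → List (Subset k)
  members {zero}  true    = [] ∷ []
  members {zero}  false   = []
  members {suc k} (t , u) = map (true ∷_) (members t) ++ map (false ∷_) (members u)

  member⇒∈members : (t : Family k) (S : Subset k) → member t S ≡ true → S ∈ members t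
  member⇒∈members {zero}  true    []          _ = here refl
  member⇒∈members {suc k} (t , u) (true ∷ S)  m = ∈-++⁺ˡ (∈-map⁺ (true ∷_) (member⇒∈members t S m))
  member⇒∈members {suc k} (t , u) (false ∷ S) m =
    ∈-++⁺ʳ (map (true ∷_) (members t)) (∈-map⁺ (false ∷_) (member⇒∈members u S m))

  ∈members⇒member : (t : Family k) (S : Subset k) → S ∈ members t → member t S ≡ true
  ∈members⇒member {zero}  true    [] _ = refl
  ∈members⇒member {suc k} (t , u) S S∈ with ∈-++⁻ (map (true ∷_) (members t)) S∈
  ... | inj₁ S∈t with ∈-map⁻ (true ∷_) S∈t
  ...   | S′ , S′∈t , refl = ∈members⇒member t S′ S′∈t
  ∈members⇒member {suc k} (t , u) S S∈ | inj₂ S∈u with ∈-map⁻ (false ∷_) S∈u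
  ...   | S′ , S′∈u , refl = ∈members⇒member u S′ S′∈u

  families : (k : ℕ) → List (Family k)
  families zero    = true ∷ false ∷ []
  families (suc k) = cartesianProduct (families k) (families k)

  _≟ᶠ_ : DecidableEquality (Family k)
  _≟ᶠ_ {zero}  = Bool._≟_
  _≟ᶠ_ {suc k} = ×-≡-dec _≟ᶠ_ _≟ᶠ_

  bools-enumerates : Enumerates Bool._≟_ (true ∷ false ∷ [])
  once bools-enumerates true  = refl
  once bools-enumerates false = refl

  families-enumerates : ∀ k → Enumerates _≟ᶠ_ (families k)
  families-enumerates zero    = bools-enumerates
  families-enumerates (suc k) =
    enumerates-cartesianProduct (families-enumerates k) (families-enumerates k)

  sumBy-allSubsets-suc : (g : Subset (suc k) → ℕ) →
    sumBy g (allSubsets (suc k)) ≡ sumBy (g ∘ (true ∷_)) (allSubsets k) + sumBy (g ∘ (false ∷_)) (allSubsets k)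
  sumBy-allSubsets-suc {k} g = trans (sumBy-++ g (map (true ∷_) (allSubsets k)) _)
    (cong₂ _+_ (sumBy-map g (true ∷_) (allSubsets k)) (sumBy-map g (false ∷_) (allSubsets k)))

  allSubsets-enumerates : ∀ k → Enumerates _≟ₛ_ (allSubsets k)
  once (allSubsets-enumerates zero)    []          = refl
  once (allSubsets-enumerates (suc k)) (true ∷ S)  = trans (sumBy-allSubsets-suc {k} _)
    (cong₂ _+_ (once (allSubsets-enumerates k) S) (sumBy-zero _ (λ _ → refl) (allSubsets k)))
  once (allSubsets-enumerates (suc k)) (false ∷ S) = trans (sumBy-allSubsets-suc {k} _)
    (cong₂ _+_ (sumBy-zero _ (λ _ → refl) (allSubsets k)) (once (allSubsets-enumerates k) S))

  count-empty : ∀ k → count (λ S → ∣ S ∣ ≡ᵇ 0) (allSubsets k) ≡ 1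
  count-empty zero    = refl
  count-empty (suc k) = trans (sumBy-allSubsets-suc {k} _)
    (cong₂ _+_ (sumBy-zero _ (λ _ → refl) (allSubsets k)) (count-empty k))

  count-singletons : ∀ k → count (λ S → ∣ S ∣ ≡ᵇ 1) (allSubsets k) ≡ k
  count-singletons zero    = refl
  count-singletons (suc k) = trans (sumBy-allSubsets-suc {k} _) (cong₂ _+_ (count-empty k) (count-singletons k))

  size : Family k → ℕ
  size {k} t = count (member t) (allSubsets k)

  size-family : (p : Subset k → Bool) → size (family p) ≡ count p (allSubsets k)
  size-family {k} p = sumBy-cong (cong bit ∘ member-family p) (allSubsets k)

  size-, : (t u : Family k) → size {suc k} (t , u) ≡ size t + size u
  size-, {k} t u = sumBy-allSubsets-suc {k} _

  length-members : (t : Family k) → length (members t) ≡ size t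
  length-members {zero}  true    = refl
  length-members {zero}  false   = refl
  length-members {suc k} (t , u) = begin
    length (map (true ∷_) (members t) ++ map (false ∷_) (members u))
      ≡⟨ length-++ (map (true ∷_) (members t)) ⟩
    length (map (true ∷_) (members t)) + length (map (false ∷_) (members u))
      ≡⟨ cong₂ _+_ (length-map (true ∷_) (members t)) (length-map (false ∷_) (members u)) ⟩
    length (members t) + length (members u)
      ≡⟨ cong₂ _+_ (length-members t) (length-members u) ⟩
    size t + size u
      ≡⟨ size-, t u ⟨
    size {suc k} (t , u) ∎
    where open ≡-Reasoning

  sumBy-sublists-∷ : (g : List A → ℕ) (x : A) (xs : List A) →
    sumBy g (sublists (x ∷ xs)) ≡ sumBy (g ∘ (x ∷_)) (sublists xs) + sumBy g (sublists xs)
  sumBy-sublists-∷ g x xs = trans (sumBy-++ g (map (x ∷_) (sublists xs)) _)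
    (cong (_+ sumBy g (sublists xs)) (sumBy-map g (x ∷_) (sublists xs)))

  sumBy-sublists-++ : (g : List A → ℕ) (xs ys : List A) →
    sumBy g (sublists (xs ++ ys)) ≡ sumBy (λ F → sumBy (λ G → g (F ++ G)) (sublists ys)) (sublists xs)
  sumBy-sublists-++ g []       ys = sym (+-identityʳ _)
  sumBy-sublists-++ g (x ∷ xs) ys = begin
    sumBy g (sublists (x ∷ xs ++ ys))
      ≡⟨ sumBy-sublists-∷ g x (xs ++ ys) ⟩
    sumBy (g ∘ (x ∷_)) (sublists (xs ++ ys)) + sumBy g (sublists (xs ++ ys))
      ≡⟨ cong₂ _+_ (sumBy-sublists-++ (g ∘ (x ∷_)) xs ys) (sumBy-sublists-++ g xs ys) ⟩
    sumBy (H ∘ (x ∷_)) (sublists xs) + sumBy H (sublists xs)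
      ≡⟨ sumBy-sublists-∷ H x xs ⟨
    sumBy H (sublists (x ∷ xs)) ∎
    where
    open ≡-Reasoning
    H = λ F → sumBy (λ G → g (F ++ G)) (sublists ys)

  sumBy-sublists-map : (g : List B → ℕ) (f : A → B) (xs : List A) →
    sumBy g (sublists (map f xs)) ≡ sumBy (g ∘ map f) (sublists xs)
  sumBy-sublists-map g f []       = refl
  sumBy-sublists-map g f (x ∷ xs) = begin
    sumBy g (sublists (f x ∷ map f xs))
      ≡⟨ sumBy-sublists-∷ g (f x) (map f xs) ⟩
    sumBy (g ∘ (f x ∷_)) (sublists (map f xs)) + sumBy g (sublists (map f xs))
      ≡⟨ cong₂ _+_ (sumBy-sublists-map (g ∘ (f x ∷_)) f xs) (sumBy-sublists-map g f xs) ⟩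
    sumBy (g ∘ map f ∘ (x ∷_)) (sublists xs) + sumBy (g ∘ map f) (sublists xs)
      ≡⟨ sumBy-sublists-∷ (g ∘ map f) x xs ⟨
    sumBy (g ∘ map f) (sublists (x ∷ xs)) ∎
    where open ≡-Reasoning

  sumBy-sublists-filter : (p : A → Bool) (g : List A → ℕ) (xs : List A) →
    sumBy g (sublists (filter (λ x → p x Bool.≟ true) xs)) ≡ sumBy (λ F → bit (all p F) * g F) (sublists xs)
  sumBy-sublists-filter p g []       = cong (_+ 0) (sym (*-identityˡ (g [])))
  sumBy-sublists-filter p g (x ∷ xs) with p x in px
  ... | true = begin
    sumBy g (sublists (x ∷ xs′))
      ≡⟨ sumBy-sublists-∷ g x xs′ ⟩
    sumBy (g ∘ (x ∷_)) (sublists xs′) + sumBy g (sublists xs′)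
      ≡⟨ cong₂ _+_ (sumBy-sublists-filter p (g ∘ (x ∷_)) xs) (sumBy-sublists-filter p g xs) ⟩
    sumBy (λ F → bit (all p F) * g (x ∷ F)) (sublists xs) + sumBy H (sublists xs)
      ≡⟨ cong (_+ sumBy H (sublists xs)) (sumBy-cong (λ F → cong (λ b → bit (b ∧ all p F) * g (x ∷ F)) (sym px)) (sublists xs)) ⟩
    sumBy (H ∘ (x ∷_)) (sublists xs) + sumBy H (sublists xs)
      ≡⟨ sumBy-sublists-∷ H x xs ⟨
    sumBy H (sublists (x ∷ xs)) ∎
    where
    open ≡-Reasoning
    xs′ = filter (λ x → p x Bool.≟ true) xs
    H = λ F → bit (all p F) * g F
  ... | false = begin
    sumBy g (sublists (filter (λ x → p x Bool.≟ true) xs))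
      ≡⟨ sumBy-sublists-filter p g xs ⟩
    sumBy H (sublists xs)
      ≡⟨ cong (_+ sumBy H (sublists xs)) (sumBy-zero _ (λ F → cong (λ b → bit (b ∧ all p F) * g (x ∷ F)) px) (sublists xs)) ⟨
    sumBy (H ∘ (x ∷_)) (sublists xs) + sumBy H (sublists xs)
      ≡⟨ sumBy-sublists-∷ H x xs ⟨
    sumBy H (sublists (x ∷ xs)) ∎
    where
    open ≡-Reasoning
    H = λ F → bit (all p F) * g F

  sumBy-sublists-allSubsets : ∀ k (g : List (Subset k) → ℕ) →
    sumBy g (sublists (allSubsets k)) ≡ sumBy (g ∘ members) (families k)
  sumBy-sublists-allSubsets zero    g = refl
  sumBy-sublists-allSubsets (suc k) g = begin
    sumBy g (sublists (map (true ∷_) U ++ map (false ∷_) U))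
      ≡⟨ sumBy-sublists-++ g (map (true ∷_) U) _ ⟩
    sumBy (λ F → sumBy (λ G → g (F ++ G)) (sublists (map (false ∷_) U))) (sublists (map (true ∷_) U))
      ≡⟨ sumBy-sublists-map _ (true ∷_) U ⟩
    sumBy (λ F → sumBy (λ G → g (map (true ∷_) F ++ G)) (sublists (map (false ∷_) U))) (sublists U)
      ≡⟨ sumBy-cong (λ F → sumBy-sublists-map _ (false ∷_) U) (sublists U) ⟩
    sumBy (λ F → sumBy (λ G → g (map (true ∷_) F ++ map (false ∷_) G)) (sublists U)) (sublists U)
      ≡⟨ sumBy-cong (λ F → sumBy-sublists-allSubsets k _) (sublists U) ⟩
    sumBy (λ F → sumBy (λ u → g (map (true ∷_) F ++ map (false ∷_) (members u))) (families k)) (sublists U)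
      ≡⟨ sumBy-sublists-allSubsets k _ ⟩
    sumBy (λ t → sumBy (λ u → g (members {suc k} (t , u))) (families k)) (families k)
      ≡⟨ sumBy-cartesianProduct (g ∘ members) (families k) (families k) ⟨
    sumBy (g ∘ members) (families (suc k)) ∎
    where
    open ≡-Reasoning
    U = allSubsets k

  isFaceᵇ : (m j : ℕ) → List (Subset (Ground m)) → Bool
  isFaceᵇ m j F = all (isVertex m) F ∧ pairwise F ∧ (length F ≡ᵇ j)

  countFaces≡count-sublists : ∀ m j →
    countFaces m j ≡ count (λ F → pairwise F ∧ (length F ≡ᵇ j)) (sublists (V m))
  countFaces≡count-sublists m j = begin
    countFaces m j
      ≡⟨ length≡count (filter LEN? (filter PW? (sublists (V m)))) ⟩
    count (λ _ → true) (filter LEN? (filter PW? (sublists (V m))))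
      ≡⟨ sumBy-filter LEN? _ (filter PW? (sublists (V m))) ⟩
    sumBy (λ F → bit (does (LEN? F)) * 1) (filter PW? (sublists (V m)))
      ≡⟨ sumBy-filter PW? _ (sublists (V m)) ⟩
    sumBy (λ F → bit (does (PW? F)) * (bit (does (LEN? F)) * 1)) (sublists (V m))
      ≡⟨ sumBy-cong indicator (sublists (V m)) ⟩
    count (λ F → pairwise F ∧ (length F ≡ᵇ j)) (sublists (V m)) ∎
    where
    open ≡-Reasoning
    LEN? = λ (F : List (Subset (Ground m))) → length F ℕ.≟ j
    PW?  = λ (F : List (Subset (Ground m))) → pairwise F Bool.≟ true
    does-LEN? : ∀ F → does (LEN? F) ≡ (length F ≡ᵇ j)
    does-LEN? F with length F ≡ᵇ j
    ... | true  = refl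
    ... | false = refl
    does-PW? : ∀ F → does (PW? F) ≡ pairwise F
    does-PW? F with pairwise F
    ... | true  = refl
    ... | false = refl
    indicator : ∀ F → bit (does (PW? F)) * (bit (does (LEN? F)) * 1) ≡ bit (pairwise F ∧ (length F ≡ᵇ j))
    indicator F = begin
      bit (does (PW? F)) * (bit (does (LEN? F)) * 1)   ≡⟨ cong₂ (λ a b → bit a * (bit b * 1)) (does-PW? F) (does-LEN? F) ⟩
      bit (pairwise F) * (bit (length F ≡ᵇ j) * 1)      ≡⟨ cong (bit (pairwise F) *_) (*-identityʳ _) ⟩
      bit (pairwise F) * bit (length F ≡ᵇ j)            ≡⟨ bit-∧ (pairwise F) _ ⟨
      bit (pairwise F ∧ (length F ≡ᵇ j))                ∎

  countFaces≡count-families : ∀ m j → countFaces m j ≡ count (isFaceᵇ m j ∘ members) (families (Ground m))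
  countFaces≡count-families m j = begin
    countFaces m j
      ≡⟨ countFaces≡count-sublists m j ⟩
    count (λ F → pairwise F ∧ (length F ≡ᵇ j)) (sublists (V m))
      ≡⟨ sumBy-sublists-filter (isVertex m) _ (allSubsets (Ground m)) ⟩
    sumBy (λ F → bit (all (isVertex m) F) * bit (pairwise F ∧ (length F ≡ᵇ j))) (sublists (allSubsets (Ground m)))
      ≡⟨ sumBy-cong (λ F → sym (bit-∧ (all (isVertex m) F) _)) (sublists (allSubsets (Ground m))) ⟩
    count (isFaceᵇ m j) (sublists (allSubsets (Ground m)))
      ≡⟨ sumBy-sublists-allSubsets (Ground m) _ ⟩
    count (isFaceᵇ m j ∘ members) (families (Ground m)) ∎
    where open ≡-Reasoning

  countFaces-zero : ∀ m → countFaces m 0 ≡ 1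
  countFaces-zero m = trans (countFaces≡count-sublists m 0) (only-[] (V m))
    where
    only-[] : (L : List (Subset (Ground m))) → count (λ F → pairwise F ∧ (length F ≡ᵇ 0)) (sublists L) ≡ 1
    only-[] []      = refl
    only-[] (S ∷ L) = trans (sumBy-sublists-∷ _ S L)
      (cong₂ _+_ (sumBy-zero _ (λ F → cong bit (∧-zeroʳ (pairwise (S ∷ F)))) (sublists L)) (only-[] L))

  record IsFace (m : ℕ) (t : Family (Ground m)) : Set where
    field
      vertices            : ∀ S → member t S ≡ true → isVertex m S ≡ true
      pairwise-compatible : ∀ S T → member t S ≡ true → member t T ≡ true → Compatible S T

  isVertex⁻ : (m : ℕ) (S : Subset (Ground m)) → isVertex m S ≡ true → 2 ≤ ∣ S ∣ × ∣ S ∣ ≤ m ∸ 2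
  isVertex⁻ m S v with ∧-true⁻ v
  ... | lower , upper = ≤ᵇ⇒≤ 2 _ (≡true⇒T lower) , ≤ᵇ⇒≤ _ (m ∸ 2) (≡true⇒T upper)

  isVertex-singleton : (m : ℕ) (S : Subset (Ground m)) → ∣ S ∣ ≡ 1 → isVertex m S ≡ false
  isVertex-singleton m S ∣S∣≡1 rewrite ∣S∣≡1 = refl

  isVertex⁺ : (m : ℕ) (S : Subset (Ground m)) → 2 ≤ ∣ S ∣ → ∣ S ∣ ≤ m ∸ 2 → isVertex m S ≡ true
  isVertex⁺ m S lower upper = cong₂ _∧_ (T⇒≡true (≤⇒≤ᵇ lower)) (T⇒≡true (≤⇒≤ᵇ upper))

  all⁻ : (p : A → Bool) (xs : List A) → all p xs ≡ true → ∀ {x} → x ∈ xs → p x ≡ true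
  all⁻ p (y ∷ xs) all≡ (here refl) = proj₁ (∧-true⁻ all≡)
  all⁻ p (y ∷ xs) all≡ (there x∈) = all⁻ p xs (proj₂ (∧-true⁻ {p y} all≡)) x∈

  all⁺ : (p : A → Bool) (xs : List A) → (∀ {x} → x ∈ xs → p x ≡ true) → all p xs ≡ true
  all⁺ p []       _  = refl
  all⁺ p (y ∷ xs) p≡ = cong₂ _∧_ (p≡ (here refl)) (all⁺ p xs (p≡ ∘ there))

  allCompat⁻ : (S : Subset k) (L : List (Subset k)) → allCompat S L ≡ true → ∀ {T} → T ∈ L → Compatible S T
  allCompat⁻ S (T ∷ L) ac (here refl) = compatible⇒Compatible S T (proj₁ (∧-true⁻ ac))
  allCompat⁻ S (T ∷ L) ac (there T∈) = allCompat⁻ S L (proj₂ (∧-true⁻ {compatible S T} ac)) T∈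

  allCompat⁺ : (S : Subset k) (L : List (Subset k)) → (∀ {T} → T ∈ L → Compatible S T) → allCompat S L ≡ true
  allCompat⁺ S []      _    = refl
  allCompat⁺ S (T ∷ L) S~L = cong₂ _∧_ (Compatible⇒compatible S T (S~L (here refl))) (allCompat⁺ S L (S~L ∘ there))

  pairwise⁻ : (L : List (Subset k)) → pairwise L ≡ true → ∀ {S T} → S ∈ L → T ∈ L → Compatible S T
  pairwise⁻ (S ∷ L) pw (here refl) (here refl) = inj₁ (λ x∈S → x∈S)
  pairwise⁻ (S ∷ L) pw (here refl) (there T∈)  = allCompat⁻ S L (proj₁ (∧-true⁻ pw)) T∈
  pairwise⁻ (S ∷ L) pw (there S∈)  (here refl) = Compatible-sym (allCompat⁻ S L (proj₁ (∧-true⁻ pw)) S∈)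
  pairwise⁻ (S ∷ L) pw (there S∈)  (there T∈)  = pairwise⁻ L (proj₂ (∧-true⁻ {allCompat S L} pw)) S∈ T∈

  pairwise⁺ : (L : List (Subset k)) → (∀ {S T} → S ∈ L → T ∈ L → Compatible S T) → pairwise L ≡ true
  pairwise⁺ []      _    = refl
  pairwise⁺ (S ∷ L) L~L =
    cong₂ _∧_ (allCompat⁺ S L (L~L (here refl) ∘ there)) (pairwise⁺ L (λ S∈ T∈ → L~L (there S∈) (there T∈)))

  module _ {m j : ℕ} {t : Family (Ground m)} where

    isFaceᵇ⇒IsFace : isFaceᵇ m j (members t) ≡ true → IsFace m t × size t ≡ j
    isFaceᵇ⇒IsFace face with ∧-true⁻ face
    ... | vs , rest with ∧-true⁻ {pairwise (members t)} rest
    ...   | pw , len = record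
      { vertices            = λ S m∈ → all⁻ (isVertex m) (members t) vs (member⇒∈members t S m∈)
      ; pairwise-compatible = λ S T S∈ T∈ → pairwise⁻ (members t) pw (member⇒∈members t S S∈) (member⇒∈members t T T∈)
      } , trans (sym (length-members t)) (≡ᵇ⇒≡ _ _ (≡true⇒T len))

    IsFace⇒isFaceᵇ : IsFace m t → size t ≡ j → isFaceᵇ m j (members t) ≡ true
    IsFace⇒isFaceᵇ F size≡ = cong₂ _∧_
      (all⁺ (isVertex m) (members t) (λ {S} S∈ → vertices S (∈members⇒member t S S∈)))
      (cong₂ _∧_
        (pairwise⁺ (members t) (λ {S} {T} S∈ T∈ →
          pairwise-compatible S T (∈members⇒member t S S∈) (∈members⇒member t T T∈)))
        (T⇒≡true (≡⇒≡ᵇ _ _ (trans (length-members t) size≡))))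
      where open IsFace F

  split-by : ∀ {a b v s} → (a ≡ true → v ≡ true × s ≡ true) → (b ≡ true → v ≡ true × s ≡ false) →
             a ≡ (v ∧ (a ∨ b)) ∧ s × b ≡ (v ∧ (a ∨ b)) ∧ not s
  split-by {true}  {true}  a⇒ b⇒ = contradiction (trans (sym (proj₂ (a⇒ refl))) (proj₂ (b⇒ refl))) λ ()
  split-by {true}  {false} a⇒ b⇒ with a⇒ refl
  ... | refl , refl = refl , refl
  split-by {false} {true}  a⇒ b⇒ with b⇒ refl
  ... | refl , refl = refl , refl
  split-by {false} {false} {v} {s} a⇒ b⇒ = sym (cong (_∧ s) (∧-zeroʳ v)) , sym (cong (_∧ not s) (∧-zeroʳ v))

  anchor-identities : ∀ {a b v o e} →
    (e ≡ true → a ≡ false × v ≡ false × o ≡ false) → (e ≡ false → a ≡ true) →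
    (a ≡ true → v ≡ not o) → (b ≡ true → o ≡ false) →
    a ≡ ((b ∨ o) ∧ not e) ∨ (v ∧ (a ∨ b)) ×
    b ≡ (b ∨ o) ∧ ((v ∧ (a ∨ b)) ∨ e) ×
    (v ∧ (a ∨ b)) ∨ ((b ∨ o) ∧ o) ∨ e ≡ true
  anchor-identities {b = true}  {e = true} e⇒ _ _ _ with e⇒ refl
  ... | refl , refl , refl = refl , refl , refl
  anchor-identities {b = false} {e = true} e⇒ _ _ _ with e⇒ refl
  ... | refl , refl , refl = refl , refl , refl
  anchor-identities {b = true} {e = false} _ ¬e⇒ a⇒ b⇒ with ¬e⇒ refl | b⇒ refl
  ... | refl | refl with a⇒ refl
  ...   | refl = refl , refl , refl
  anchor-identities {b = false} {o = true} {e = false} _ ¬e⇒ a⇒ _ with ¬e⇒ refl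
  ... | refl with a⇒ refl
  ...   | refl = refl , refl , refl
  anchor-identities {b = false} {o = false} {e = false} _ ¬e⇒ a⇒ _ with ¬e⇒ refl
  ... | refl with a⇒ refl
  ...   | refl = refl , refl , refl

  rejoin : ∀ {v a} s → (a ≡ true → v ≡ true) → v ∧ ((a ∧ s) ∨ (a ∧ not s)) ≡ a
  rejoin {a = false} s     _  = ∧-zeroʳ _
  rejoin {a = true}  true  a⇒ = trans (∧-identityʳ _) (a⇒ refl)
  rejoin {a = true}  false a⇒ = trans (∧-identityʳ _) (a⇒ refl)

  rejoin-anchor : ∀ {v l a} e → (a ≡ true → v ≡ true) → (l ≡ true → a ≡ false → v ≡ false) →
                  v ∧ (((l ∧ not e) ∨ a) ∨ (l ∧ (a ∨ e))) ≡ a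
  rejoin-anchor {l = l} {true}      e     a⇒ _  rewrite a⇒ refl | ∨-zeroʳ (l ∧ not e) = refl
  rejoin-anchor {l = false} {false} e     _  _  = ∧-zeroʳ _
  rejoin-anchor {l = true}  {false} false _  l⇒ rewrite l⇒ refl refl = refl
  rejoin-anchor {l = true}  {false} true  _  l⇒ rewrite l⇒ refl refl = refl

  lost-identity : ∀ {l a o e} → a ∨ (l ∧ o) ∨ e ≡ true → (l ≡ false → o ≡ false) → (l ∧ (a ∨ e)) ∨ o ≡ l
  lost-identity {false}                      _   l⇒ = l⇒ refl
  lost-identity {true} {true}                _   _  = refl
  lost-identity {true} {false} {true}        _   _  = ∨-zeroʳ _
  lost-identity {true} {false} {false} {true} _  _  = refl

  anchor-bits : ∀ l e a → bit ((l ∧ not e) ∨ a) + bit (l ∧ (a ∨ e)) ≡ bit a + bit l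
  anchor-bits false e     false = refl
  anchor-bits false e     true  = refl
  anchor-bits true  false false = refl
  anchor-bits true  true  false = refl
  anchor-bits true  false true  = refl
  anchor-bits true  true  true  = refl

  -- Δ_n lives on Fin (suc K) and Δ_{n-1} on Fin K. A family (x , y) on Fin (suc K) consists of
  -- the sets containing the first point (which stands for 2) with that point deleted, and the
  -- sets avoiding it.
  module Recurrence (m′ : ℕ) where

    K n : ℕ
    K = suc (suc m′)
    n = suc (suc K)

    U : List (Subset K)
    U = allSubsets K

    -- The inverse of the reduction: the sets of z containing c go back to the chain and the others
    -- to the sets avoiding 2; if a vertex was lost (l), c itself is also put into the chain unless
    -- it is the whole set, and among the sets avoiding 2 if it lies in z or is the whole set.
    withPoint withoutPoint : Bool → Family K → Subset K → Subset K → Bool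
    withPoint    l z c T = (does (T ≟ₛ c) ∧ l ∧ not (does (c ≟ₛ ⊤))) ∨ (member z T ∧ does (c ⊆? T))
    withoutPoint l z c T = (does (T ≟ₛ c) ∧ l ∧ (member z c ∨ does (c ≟ₛ ⊤))) ∨ (member z T ∧ not (does (c ⊆? T)))

    module _ (l : Bool) (z : Family K) (c : Subset K) where

      withPoint-≢ : ∀ {T} → T ≢ c → withPoint l z c T ≡ member z T ∧ does (c ⊆? T)
      withPoint-≢ {T} T≢c rewrite dec-false (T ≟ₛ c) T≢c = refl

      withoutPoint-≢ : ∀ {T} → T ≢ c → withoutPoint l z c T ≡ member z T ∧ not (does (c ⊆? T))
      withoutPoint-≢ {T} T≢c rewrite dec-false (T ≟ₛ c) T≢c = refl

      withPoint-self : withPoint l z c c ≡ (l ∧ not (does (c ≟ₛ ⊤))) ∨ member z c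
      withPoint-self rewrite dec-true (c ≟ₛ c) refl | dec-true (c ⊆? c) ⊆-refl =
        cong ((l ∧ not (does (c ≟ₛ ⊤))) ∨_) (∧-identityʳ (member z c))

      withoutPoint-self : withoutPoint l z c c ≡ l ∧ (member z c ∨ does (c ≟ₛ ⊤))
      withoutPoint-self rewrite dec-true (c ≟ₛ c) refl | dec-true (c ⊆? c) ⊆-refl
                              | ∧-zeroʳ (member z c) = ∨-identityʳ _

      bits-split : ∀ T → Dec (T ≡ c) →
                   bit (withPoint l z c T) + bit (withoutPoint l z c T) ≡ bit (member z T) + bit (does (T ≟ₛ c) ∧ l)
      bits-split T (no T≢c) rewrite withPoint-≢ T≢c | withoutPoint-≢ T≢c | dec-false (T ≟ₛ c) T≢c =
        trans (bit-split (member z T) _) (sym (+-identityʳ _))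
      bits-split T (yes refl) rewrite withPoint-self | withoutPoint-self | dec-true (T ≟ₛ T) refl =
        anchor-bits l (does (T ≟ₛ ⊤)) (member z T)

      split-size : count (withPoint l z c) U + count (withoutPoint l z c) U ≡ size z + bit l
      split-size = begin
        count (withPoint l z c) U + count (withoutPoint l z c) U
          ≡⟨ sumBy-+ U ⟨
        sumBy (λ T → bit (withPoint l z c T) + bit (withoutPoint l z c T)) U
          ≡⟨ sumBy-cong (λ T → bits-split T (T ≟ₛ c)) U ⟩
        sumBy (λ T → bit (member z T) + bit (does (T ≟ₛ c) ∧ l)) U
          ≡⟨ sumBy-+ U ⟩
        size z + count (λ T → does (T ≟ₛ c) ∧ l) U
          ≡⟨ cong (size z +_) (count-≟-∧ (allSubsets-enumerates K) c l) ⟩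
        size z + bit l ∎
        where open ≡-Reasoning

    anchor : Family K → Subset K
    anchor x = ⋂ (members x)

    restrict : Family K → Family K → Family K
    restrict x y = family (λ T → isVertex (n ∸ 1) T ∧ (member x T ∨ member y T))

    lost : Family K → Family K → Bool
    lost x y = member y (anchor x) ∨ (∣ anchor x ∣ ≡ᵇ 1)

    admissible : Bool → Family K → Subset K → Bool
    admissible l z c = member z c ∨ (l ∧ (∣ c ∣ ≡ᵇ 1)) ∨ does (c ≟ₛ ⊤)

    ∣⊤∣≰1+m′ : ¬ ∣ ⊤ {K} ∣ ≤ suc m′
    ∣⊤∣≰1+m′ = <⇒≱ ≤-refl ∘ subst (_≤ suc m′) (∣⊤∣≡n K)

    isVertex-⊤ : ∀ {c} → c ≡ ⊤ → isVertex (n ∸ 1) c ≡ false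
    isVertex-⊤ refl = ¬-not (∣⊤∣≰1+m′ ∘ proj₂ ∘ isVertex⁻ (n ∸ 1) ⊤)

    isVertex-≡-not-singleton : (T : Subset K) → 1 ≤ ∣ T ∣ → ∣ T ∣ ≤ suc m′ → isVertex (n ∸ 1) T ≡ not (∣ T ∣ ≡ᵇ 1)
    isVertex-≡-not-singleton T = by-size ∣ T ∣
      where
      by-size : ∀ s → 1 ≤ s → s ≤ suc m′ → (2 ≤ᵇ s) ∧ (s ≤ᵇ suc m′) ≡ not (s ≡ᵇ 1)
      by-size 1             _ _  = refl
      by-size (suc (suc s)) _ s≤ = T⇒≡true (≤⇒≤ᵇ s≤)

    module Forward (x y : Family K) (F : IsFace n (x , y)) where
      open IsFace F

      c : Subset K
      c = anchor x

      z : Family K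
      z = restrict x y

      l : Bool
      l = lost x y

      through-size : ∀ T → member x T ≡ true → 1 ≤ ∣ T ∣ × ∣ T ∣ ≤ suc m′
      through-size T xT with isVertex⁻ n (true ∷ T) (vertices (true ∷ T) xT)
      ... | lo , hi = s≤s⁻¹ lo , s≤s⁻¹ hi

      away-size : ∀ T → member y T ≡ true → 2 ≤ ∣ T ∣ × ∣ T ∣ ≤ K
      away-size T yT = isVertex⁻ n (false ∷ T) (vertices (false ∷ T) yT)

      through-chain : ∀ S T → member x S ≡ true → member x T ≡ true → S ⊆ T ⊎ T ⊆ S
      through-chain S T xS xT with pairwise-compatible (true ∷ S) (true ∷ T) xS xT
      ... | inj₁ S⊆T        = inj₁ (drop-∷-⊆ S⊆T)
      ... | inj₂ (inj₁ T⊆S) = inj₂ (drop-∷-⊆ T⊆S)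

      through-away : ∀ S T → member x S ≡ true → member y T ≡ true → T ⊆ S ⊎ Disjoint S T
      through-away S T xS yT with pairwise-compatible (true ∷ S) (false ∷ T) xS yT
      ... | inj₁ S⊆T        = contradiction (S⊆T here) λ ()
      ... | inj₂ (inj₁ T⊆S) = inj₁ (drop-∷-⊆ T⊆S)
      ... | inj₂ (inj₂ d)   = inj₂ d

      c⊆through : ∀ T → member x T ≡ true → c ⊆ T
      c⊆through T xT = ⋂-lowerBound (member⇒∈members x T xT)

      c-cases : c ≡ ⊤ ⊎ member x c ≡ true
      c-cases with ⋂-chain (members x) (λ {S} {T} S∈ T∈ →
                     through-chain S T (∈members⇒member x S S∈) (∈members⇒member x T T∈))
      ... | inj₁ c≡⊤ = inj₁ c≡⊤
      ... | inj₂ c∈x = inj₂ (∈members⇒member x c c∈x)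

      1≤∣c∣ : 1 ≤ ∣ c ∣
      1≤∣c∣ with c-cases
      ... | inj₁ c≡⊤ = subst (λ S → 1 ≤ ∣ S ∣) (sym c≡⊤) (s≤s z≤n)
      ... | inj₂ xc  = proj₁ (through-size c xc)

      away-⊇c⇒≡c : ∀ T → member y T ≡ true → c ⊆ T → T ≡ c
      away-⊇c⇒≡c T yT c⊆T with c-cases
      ... | inj₁ c≡⊤ = trans (⊆-antisym ⊆⊤ (subst (_⊆ T) c≡⊤ c⊆T)) (sym c≡⊤)
      ... | inj₂ xc with through-away c T xc yT
      ...   | inj₁ T⊆c = ⊆-antisym T⊆c c⊆T
      ...   | inj₂ d   = contradiction (subst (1 ≤_) (common-⊆-Disjoint⇒∣∣≡0 ⊆-refl c⊆T d) 1≤∣c∣) λ ()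

      through-isVertex : ∀ T → T ≢ c → member x T ≡ true → isVertex (n ∸ 1) T ≡ true
      through-isVertex T T≢c xT = isVertex⁺ (n ∸ 1) T 2≤∣T∣ (proj₂ (through-size T xT))
        where
        2≤∣T∣ : 2 ≤ ∣ T ∣
        2≤∣T∣ with ∣ T ∣ ℕ.≤? ∣ c ∣
        ... | yes ∣T∣≤∣c∣ = contradiction (sym (p⊆q⇒∣q∣≤∣p∣⇒p≡q (c⊆through T xT) ∣T∣≤∣c∣)) T≢c
        ... | no  ∣T∣≰∣c∣ = ≤-trans (s≤s 1≤∣c∣) (≰⇒> ∣T∣≰∣c∣)

      away-isVertex : ∀ T → T ≢ c → member y T ≡ true → isVertex (n ∸ 1) T ≡ true
      away-isVertex T T≢c yT =
        isVertex⁺ (n ∸ 1) T (proj₁ (away-size T yT)) (s≤s⁻¹ (≤∧≢⇒< (proj₂ (away-size T yT)) ∣T∣≢K))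
        where
        ∣T∣≢K : ∣ T ∣ ≢ K
        ∣T∣≢K ∣T∣≡K = T≢c (away-⊇c⇒≡c T yT (subst (c ⊆_) (sym (∣p∣≡n⇒p≡⊤ ∣T∣≡K)) ⊆⊤))

      z-at : ∀ T → member z T ≡ isVertex (n ∸ 1) T ∧ (member x T ∨ member y T)
      z-at = member-family _

      decomposition-≢ : ∀ T → T ≢ c → member x T ≡ withPoint l z c T × member y T ≡ withoutPoint l z c T
      decomposition-≢ T T≢c with split-by {member x T} {member y T} {isVertex (n ∸ 1) T} {does (c ⊆? T)}
          (λ xT → through-isVertex T T≢c xT , dec-true (c ⊆? T) (c⊆through T xT))
          (λ yT → away-isVertex T T≢c yT , dec-false (c ⊆? T) (T≢c ∘ away-⊇c⇒≡c T yT))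
      ... | x≡ , y≡ = trans x≡ (trans (cong (_∧ _) (sym (z-at T))) (sym (withPoint-≢ l z c T≢c))) ,
                      trans y≡ (trans (cong (_∧ _) (sym (z-at T))) (sym (withoutPoint-≢ l z c T≢c)))

      c≡⊤-facts : does (c ≟ₛ ⊤) ≡ true → member x c ≡ false × isVertex (n ∸ 1) c ≡ false × (∣ c ∣ ≡ᵇ 1) ≡ false
      c≡⊤-facts e with does⇒ (c ≟ₛ ⊤) e
      ... | c≡⊤ = ¬-not (λ xc → ∣⊤∣≰1+m′ (proj₂ (through-size ⊤ (subst (λ S → member x S ≡ true) c≡⊤ xc)))) ,
                  isVertex-⊤ c≡⊤ ,
                  cong (λ S → ∣ S ∣ ≡ᵇ 1) c≡⊤

      c≢⊤⇒through : does (c ≟ₛ ⊤) ≡ false → member x c ≡ true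
      c≢⊤⇒through e with c-cases
      ... | inj₁ c≡⊤ = contradiction c≡⊤ (does⇒¬ (c ≟ₛ ⊤) e)
      ... | inj₂ xc  = xc

      through-c-isVertex : member x c ≡ true → isVertex (n ∸ 1) c ≡ not (∣ c ∣ ≡ᵇ 1)
      through-c-isVertex xc = isVertex-≡-not-singleton c (proj₁ (through-size c xc)) (proj₂ (through-size c xc))

      away-c-non-singleton : member y c ≡ true → (∣ c ∣ ≡ᵇ 1) ≡ false
      away-c-non-singleton yc = ≥2⇒≢ᵇ1 (proj₁ (away-size c yc))

      decomposition-c : member x c ≡ withPoint l z c c × member y c ≡ withoutPoint l z c c
      decomposition-c with anchor-identities c≡⊤-facts c≢⊤⇒through through-c-isVertex away-c-non-singleton
      ... | x≡ , y≡ , _ =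
        trans x≡ (trans (cong ((l ∧ not (does (c ≟ₛ ⊤))) ∨_) (sym (z-at c))) (sym (withPoint-self l z c))) ,
        trans y≡ (trans (cong (λ w → l ∧ (w ∨ does (c ≟ₛ ⊤))) (sym (z-at c))) (sym (withoutPoint-self l z c)))

      c-admissible : admissible l z c ≡ true
      c-admissible with anchor-identities c≡⊤-facts c≢⊤⇒through through-c-isVertex away-c-non-singleton
      ... | _ , _ , adm = trans (cong (_∨ ((l ∧ (∣ c ∣ ≡ᵇ 1)) ∨ does (c ≟ₛ ⊤))) (z-at c)) adm

      decomposition : ∀ T → Dec (T ≡ c) → member x T ≡ withPoint l z c T × member y T ≡ withoutPoint l z c T
      decomposition T (yes refl) = decomposition-c
      decomposition T (no T≢c)   = decomposition-≢ T T≢c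

      size-relation : size {suc K} (x , y) ≡ size z + bit l
      size-relation = begin
        size {suc K} (x , y)
          ≡⟨ size-, x y ⟩
        size x + size y
          ≡⟨ cong₂ _+_ (sumBy-cong (λ T → cong bit (proj₁ (decomposition T (T ≟ₛ c)))) U)
                       (sumBy-cong (λ T → cong bit (proj₂ (decomposition T (T ≟ₛ c)))) U) ⟩
        count (withPoint l z c) U + count (withoutPoint l z c) U
          ≡⟨ split-size l z c ⟩
        size z + bit l ∎
        where open ≡-Reasoning

      z-face : IsFace (n ∸ 1) z
      z-face = record
        { vertices            = λ T zT → proj₁ (∧-true⁻ (trans (sym (z-at T)) zT))
        ; pairwise-compatible = λ S T zS zT → compatible-lift (lift S zS) (lift T zT)
        }
        where
        lift : ∀ T → member z T ≡ true → Σ Bool λ a → member {suc K} (x , y) (a ∷ T) ≡ true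
        lift T zT with ∨-true⁻ (proj₂ (∧-true⁻ {isVertex (n ∸ 1) T} (trans (sym (z-at T)) zT)))
        ... | inj₁ xT = true , xT
        ... | inj₂ yT = false , yT
        compatible-lift : ∀ {S T} → Σ Bool (λ a → member {suc K} (x , y) (a ∷ S) ≡ true) →
                          Σ Bool (λ b → member {suc K} (x , y) (b ∷ T) ≡ true) → Compatible S T
        compatible-lift {S} {T} (a , aS) (b , bT) = Compatible-∷⁻ a b (pairwise-compatible (a ∷ S) (b ∷ T) aS bT)

    module Backward (l : Bool) (z : Family K) (c : Subset K) (Fz : IsFace (n ∸ 1) z)
                    (adm : admissible l z c ≡ true) where
      open IsFace Fz

      x y : Family K
      x = family (withPoint l z c)
      y = family (withoutPoint l z c)

      x-at : ∀ T → member x T ≡ withPoint l z c T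
      x-at = member-family (withPoint l z c)

      y-at : ∀ T → member y T ≡ withoutPoint l z c T
      y-at = member-family (withoutPoint l z c)

      z-size : ∀ T → member z T ≡ true → 2 ≤ ∣ T ∣ × ∣ T ∣ ≤ suc m′
      z-size T zT = isVertex⁻ (n ∸ 1) T (vertices T zT)

      adm-cases : member z c ≡ true ⊎ (l ≡ true × ∣ c ∣ ≡ 1) ⊎ c ≡ ⊤
      adm-cases with ∨-true⁻ adm
      ... | inj₁ zc = inj₁ zc
      ... | inj₂ rest with ∨-true⁻ rest
      ...   | inj₂ e   = inj₂ (inj₂ (does⇒ (c ≟ₛ ⊤) e))
      ...   | inj₁ l∧o with ∧-true⁻ l∧o
      ...     | l≡ , o≡ = inj₂ (inj₁ (l≡ , ≡ᵇ⇒≡ _ 1 (≡true⇒T o≡)))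

      1≤∣c∣ : 1 ≤ ∣ c ∣
      1≤∣c∣ with adm-cases
      ... | inj₁ zc                 = ≤-trans (s≤s z≤n) (proj₁ (z-size c zc))
      ... | inj₂ (inj₁ (_ , ∣c∣≡1)) = subst (1 ≤_) (sym ∣c∣≡1) ≤-refl
      ... | inj₂ (inj₂ c≡⊤)         = subst (λ S → 1 ≤ ∣ S ∣) (sym c≡⊤) (s≤s z≤n)

      x-cases : ∀ T → Dec (T ≡ c) → member x T ≡ true → (member z T ≡ true × c ⊆ T) ⊎ (T ≡ c × l ≡ true × c ≢ ⊤)
      x-cases T (no T≢c) xT with ∧-true⁻ (trans (sym (withPoint-≢ l z c T≢c)) (trans (sym (x-at T)) xT))
      ... | zT , c⊆T = inj₁ (zT , does⇒ (c ⊆? T) c⊆T)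
      x-cases T (yes refl) xT with ∨-true⁻ (trans (sym (withPoint-self l z c)) (trans (sym (x-at c)) xT))
      ... | inj₂ zc  = inj₁ (zc , ⊆-refl)
      ... | inj₁ l∧e with ∧-true⁻ l∧e
      ...   | l≡ , ¬e = inj₂ (refl , l≡ , does⇒¬ (c ≟ₛ ⊤) (not-true⁻ ¬e))

      y-cases : ∀ T → Dec (T ≡ c) → member y T ≡ true →
                (member z T ≡ true × ¬ c ⊆ T) ⊎ (T ≡ c × (member z c ≡ true ⊎ c ≡ ⊤))
      y-cases T (no T≢c) yT with ∧-true⁻ (trans (sym (withoutPoint-≢ l z c T≢c)) (trans (sym (y-at T)) yT))
      ... | zT , c⊈T = inj₁ (zT , does⇒¬ (c ⊆? T) (not-true⁻ c⊈T))
      y-cases T (yes refl) yT with ∨-true⁻ (proj₂ (∧-true⁻ {l} (trans (sym (withoutPoint-self l z c)) (trans (sym (y-at c)) yT))))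
      ... | inj₁ zc = inj₂ (refl , inj₁ zc)
      ... | inj₂ e  = inj₂ (refl , inj₂ (does⇒ (c ≟ₛ ⊤) e))

      c⊆through : ∀ T → member x T ≡ true → c ⊆ T
      c⊆through T xT with x-cases T (T ≟ₛ c) xT
      ... | inj₁ (_ , c⊆T)  = c⊆T
      ... | inj₂ (refl , _) = ⊆-refl

      through-lower : ∀ T → member x T ≡ true → member z T ≡ true ⊎ (T ≡ c × ∣ c ∣ ≡ 1)
      through-lower T xT with x-cases T (T ≟ₛ c) xT
      ... | inj₁ (zT , _) = inj₁ zT
      ... | inj₂ (refl , _ , c≢⊤) with adm-cases
      ...   | inj₁ zc                  = inj₁ zc
      ...   | inj₂ (inj₁ (_ , ∣c∣≡1)) = inj₂ (refl , ∣c∣≡1)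
      ...   | inj₂ (inj₂ c≡⊤)         = contradiction c≡⊤ c≢⊤

      away-lower : ∀ T → member y T ≡ true → member z T ≡ true ⊎ T ≡ ⊤
      away-lower T yT with y-cases T (T ≟ₛ c) yT
      ... | inj₁ (zT , _)           = inj₁ zT
      ... | inj₂ (refl , inj₁ zc)   = inj₁ zc
      ... | inj₂ (refl , inj₂ c≡⊤)  = inj₂ c≡⊤

      through-size : ∀ T → member x T ≡ true → 1 ≤ ∣ T ∣ × ∣ T ∣ ≤ suc m′
      through-size T xT with through-lower T xT
      ... | inj₁ zT             = ≤-trans (s≤s z≤n) (proj₁ (z-size T zT)) , proj₂ (z-size T zT)
      ... | inj₂ (refl , ∣c∣≡1) = subst (1 ≤_) (sym ∣c∣≡1) ≤-refl , subst (_≤ suc m′) (sym ∣c∣≡1) (s≤s z≤n)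

      away-size : ∀ T → member y T ≡ true → 2 ≤ ∣ T ∣ × ∣ T ∣ ≤ K
      away-size T yT with away-lower T yT
      ... | inj₁ zT   = proj₁ (z-size T zT) , m≤n⇒m≤1+n (proj₂ (z-size T zT))
      ... | inj₂ refl = subst (2 ≤_) (sym (∣⊤∣≡n K)) (s≤s (s≤s z≤n)) , subst (_≤ K) (sym (∣⊤∣≡n K)) ≤-refl

      through-chain : ∀ S T → member x S ≡ true → member x T ≡ true → S ⊆ T ⊎ T ⊆ S
      through-chain S T xS xT with through-lower S xS | through-lower T xT
      ... | inj₂ (refl , _) | _               = inj₁ (c⊆through T xT)
      ... | inj₁ _          | inj₂ (refl , _) = inj₂ (c⊆through S xS)
      ... | inj₁ zS         | inj₁ zT with pairwise-compatible S T zS zT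
      ...   | inj₁ S⊆T        = inj₁ S⊆T
      ...   | inj₂ (inj₁ T⊆S) = inj₂ T⊆S
      ...   | inj₂ (inj₂ d)   =
        contradiction (subst (1 ≤_) (common-⊆-Disjoint⇒∣∣≡0 (c⊆through S xS) (c⊆through T xT) d) 1≤∣c∣) λ ()

      through-away : ∀ S T → member x S ≡ true → member y T ≡ true → T ⊆ S ⊎ Disjoint S T
      through-away S T xS yT with y-cases T (T ≟ₛ c) yT
      ... | inj₂ (refl , _)  = inj₁ (c⊆through S xS)
      ... | inj₁ (zT , c⊈T) with through-lower S xS
      ...   | inj₂ (refl , ∣c∣≡1) with ∣p∣≡1⇒p⊆q⊎Disjoint c T ∣c∣≡1
      ...     | inj₁ c⊆T = ⊥-elim (c⊈T c⊆T)
      ...     | inj₂ d   = inj₂ d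
      through-away S T xS yT | inj₁ (zT , c⊈T) | inj₁ zS with pairwise-compatible S T zS zT
      ...     | inj₁ S⊆T        = ⊥-elim (c⊈T (⊆-trans (c⊆through S xS) S⊆T))
      ...     | inj₂ (inj₁ T⊆S) = inj₁ T⊆S
      ...     | inj₂ (inj₂ d)   = inj₂ d

      away-compatible : ∀ S T → member y S ≡ true → member y T ≡ true → Compatible S T
      away-compatible S T yS yT with away-lower S yS | away-lower T yT
      ... | inj₂ refl | _         = inj₂ (inj₁ ⊆⊤)
      ... | inj₁ _    | inj₂ refl = inj₁ ⊆⊤
      ... | inj₁ zS   | inj₁ zT   = pairwise-compatible S T zS zT

      xy-face : IsFace n (x , y)
      xy-face = record { vertices = xy-vertices ; pairwise-compatible = xy-compatible }
        where
        xy-vertices : ∀ S → member {suc K} (x , y) S ≡ true → isVertex n S ≡ true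
        xy-vertices (true ∷ T)  xT = isVertex⁺ n (true ∷ T) (s≤s (proj₁ (through-size T xT))) (s≤s (proj₂ (through-size T xT)))
        xy-vertices (false ∷ T) yT = isVertex⁺ n (false ∷ T) (proj₁ (away-size T yT)) (proj₂ (away-size T yT))
        xy-compatible : ∀ S T → member {suc K} (x , y) S ≡ true → member {suc K} (x , y) T ≡ true → Compatible S T
        xy-compatible (true ∷ S) (true ∷ T) xS xT with through-chain S T xS xT
        ... | inj₁ S⊆T = inj₁ (in⊆in S⊆T)
        ... | inj₂ T⊆S = inj₂ (inj₁ (in⊆in T⊆S))
        xy-compatible (true ∷ S) (false ∷ T) xS yT with through-away S T xS yT
        ... | inj₁ T⊆S = inj₂ (inj₁ (out⊆ T⊆S))
        ... | inj₂ d   = inj₂ (inj₂ d)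
        xy-compatible (false ∷ S) (true ∷ T) yS xT = Compatible-sym (xy-compatible (true ∷ T) (false ∷ S) xT yS)
        xy-compatible (false ∷ S) (false ∷ T) yS yT with away-compatible S T yS yT
        ... | inj₁ S⊆T        = inj₁ (s⊆s S⊆T)
        ... | inj₂ (inj₁ T⊆S) = inj₂ (inj₁ (s⊆s T⊆S))
        ... | inj₂ (inj₂ d)   = inj₂ (inj₂ d)

      through-c : c ≢ ⊤ → member x c ≡ true
      through-c c≢⊤ = trans (x-at c) (trans (withPoint-self l z c) (at-c adm-cases))
        where
        at-c : member z c ≡ true ⊎ (l ≡ true × ∣ c ∣ ≡ 1) ⊎ c ≡ ⊤ → (l ∧ not (does (c ≟ₛ ⊤))) ∨ member z c ≡ true
        at-c (inj₁ zc)                = trans (cong (_ ∨_) zc) (∨-zeroʳ _)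
        at-c (inj₂ (inj₁ (refl , _))) rewrite dec-false (c ≟ₛ ⊤) c≢⊤ = refl
        at-c (inj₂ (inj₂ c≡⊤))        = contradiction c≡⊤ c≢⊤

      anchor-xy : anchor x ≡ c
      anchor-xy = ⋂-unique (members x) (λ {S} S∈ → c⊆through S (∈members⇒member x S S∈)) (c-cases (c ≟ₛ ⊤))
        where
        c-cases : Dec (c ≡ ⊤) → c ≡ ⊤ ⊎ c ∈ members x
        c-cases (yes c≡⊤) = inj₁ c≡⊤
        c-cases (no  c≢⊤) = inj₂ (member⇒∈members x c (through-c c≢⊤))

      lost-xy : lost x y ≡ l
      lost-xy rewrite anchor-xy = trans (cong (_∨ (∣ c ∣ ≡ᵇ 1)) (trans (y-at c) (withoutPoint-self l z c)))
                                        (lost-identity {a = member z c} {e = does (c ≟ₛ ⊤)} adm ¬l⇒non-singleton)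
        where
        ¬l⇒non-singleton : l ≡ false → (∣ c ∣ ≡ᵇ 1) ≡ false
        ¬l⇒non-singleton l≡false with adm-cases
        ... | inj₁ zc                  = ≥2⇒≢ᵇ1 (proj₁ (z-size c zc))
        ... | inj₂ (inj₁ (l≡true , _)) = contradiction (trans (sym l≡true) l≡false) λ ()
        ... | inj₂ (inj₂ c≡⊤)          = cong (λ S → ∣ S ∣ ≡ᵇ 1) c≡⊤

      restrict-xy : restrict x y ≡ z
      restrict-xy = family-unique _ z λ T → at T (T ≟ₛ c)
        where
        lost⇒¬isVertex : l ≡ true → member z c ≡ false → isVertex (n ∸ 1) c ≡ false
        lost⇒¬isVertex _ ¬zc with adm-cases
        ... | inj₁ zc                 = contradiction (trans (sym ¬zc) zc) λ ()
        ... | inj₂ (inj₁ (_ , ∣c∣≡1)) = isVertex-singleton (n ∸ 1) c ∣c∣≡1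
        ... | inj₂ (inj₂ c≡⊤)         = isVertex-⊤ c≡⊤
        at : ∀ T → Dec (T ≡ c) → isVertex (n ∸ 1) T ∧ (member x T ∨ member y T) ≡ member z T
        at T (no T≢c) = trans (cong (λ w → isVertex (n ∸ 1) T ∧ w)
                                    (cong₂ _∨_ (trans (x-at T) (withPoint-≢ l z c T≢c)) (trans (y-at T) (withoutPoint-≢ l z c T≢c))))
                              (rejoin (does (c ⊆? T)) (vertices T))
        at T (yes refl) = trans (cong (λ w → isVertex (n ∸ 1) c ∧ w)
                                      (cong₂ _∨_ (trans (x-at c) (withPoint-self l z c)) (trans (y-at c) (withoutPoint-self l z c))))
                                (rejoin-anchor (does (c ≟ₛ ⊤)) (vertices c) lost⇒¬isVertex)

      size-relation : size {suc K} (x , y) ≡ size z + bit l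
      size-relation = trans (size-, x y) (trans (cong₂ _+_ (size-family (withPoint l z c)) (size-family (withoutPoint l z c)))
                                                (split-size l z c))

    Reduced : Set
    Reduced = Bool × Family K × Subset K

    _≟ᵣ_ : DecidableEquality Reduced
    _≟ᵣ_ = ×-≡-dec Bool._≟_ (×-≡-dec _≟ᶠ_ _≟ₛ_)

    reductions : List Reduced
    reductions = cartesianProduct (true ∷ false ∷ []) (cartesianProduct (families K) U)

    reductions-enumerate : Enumerates _≟ᵣ_ reductions
    reductions-enumerate = enumerates-cartesianProduct bools-enumerates
      (enumerates-cartesianProduct (families-enumerates K) (allSubsets-enumerates K))

    reduce : Family (suc K) → Reduced
    reduce (x , y) = lost x y , restrict x y , anchor x

    rebuild : Reduced → Family (suc K)
    rebuild (l , z , c) = family (withPoint l z c) , family (withoutPoint l z c)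

    reducedSize : Bool → ℕ → ℕ
    reducedSize l i = if l then i else suc i

    +bit≡suc⇒ : ∀ l {j i} → j + bit l ≡ suc i → j ≡ reducedSize l i
    +bit≡suc⇒ true  {j} eq = suc-injective (trans (+-comm 1 j) eq)
    +bit≡suc⇒ false {j} eq = trans (sym (+-identityʳ j)) eq

    ⇒+bit≡suc : ∀ l {j i} → j ≡ reducedSize l i → j + bit l ≡ suc i
    ⇒+bit≡suc true  {i = i} refl = +-comm i 1
    ⇒+bit≡suc false         refl = +-identityʳ _

    admissible-count : ∀ l z → IsFace (n ∸ 1) z → count (admissible l z) U ≡ size z + (bit l * K + 1)
    admissible-count l z Fz = begin
      count (admissible l z) U
        ≡⟨ sumBy-cong (λ c → trans (bit-∨ (member z c) _ (z-excl c))
                                   (cong (bit (member z c) +_) (bit-∨ (l ∧ (∣ c ∣ ≡ᵇ 1)) _ (singleton-excl c)))) U ⟩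
      sumBy (λ c → bit (member z c) + (bit (l ∧ (∣ c ∣ ≡ᵇ 1)) + bit (does (c ≟ₛ ⊤)))) U
        ≡⟨ trans (sumBy-+ U) (cong (size z +_) (sumBy-+ U)) ⟩
      size z + (count (λ c → l ∧ (∣ c ∣ ≡ᵇ 1)) U + count (λ c → does (c ≟ₛ ⊤)) U)
        ≡⟨ cong (λ w → size z + (w + count (λ c → does (c ≟ₛ ⊤)) U)) singletons ⟩
      size z + (bit l * K + count (λ c → does (c ≟ₛ ⊤)) U)
        ≡⟨ cong (λ w → size z + (bit l * K + w)) (once (allSubsets-enumerates K) ⊤) ⟩
      size z + (bit l * K + 1) ∎
      where
      open ≡-Reasoning
      open IsFace Fz
      singletons : count (λ c → l ∧ (∣ c ∣ ≡ᵇ 1)) U ≡ bit l * K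
      singletons = trans (sumBy-cong (λ c → bit-∧ l _) U) (trans (sumBy-*ˡ _ (bit l) U) (cong (bit l *_) (count-singletons K)))
      ⊤-non-singleton : ∀ c → does (c ≟ₛ ⊤) ≡ true → (∣ c ∣ ≡ᵇ 1) ≡ false
      ⊤-non-singleton c e = cong (λ S → ∣ S ∣ ≡ᵇ 1) (does⇒ (c ≟ₛ ⊤) e)
      singleton-excl : ∀ c → l ∧ (∣ c ∣ ≡ᵇ 1) ≡ true → ¬ does (c ≟ₛ ⊤) ≡ true
      singleton-excl c l∧o e = contradiction (trans (sym (proj₂ (∧-true⁻ {l} l∧o))) (⊤-non-singleton c e)) λ ()
      z-excl : ∀ c → member z c ≡ true → ¬ (l ∧ (∣ c ∣ ≡ᵇ 1)) ∨ does (c ≟ₛ ⊤) ≡ true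
      z-excl c zc rest with ∨-true⁻ rest
      ... | inj₁ l∧o = contradiction (trans (sym (proj₂ (∧-true⁻ {l} l∧o))) (≥2⇒≢ᵇ1 (proj₁ (isVertex⁻ (n ∸ 1) c (vertices c zc)))))
                         λ ()
      ... | inj₂ e   = contradiction (trans (sym (vertices c zc)) (isVertex-⊤ (does⇒ (c ≟ₛ ⊤) e))) λ ()

    module _ (i : ℕ) where

      isFaceₙ : Family (suc K) → Bool
      isFaceₙ t = isFaceᵇ n (suc i) (members t)

      isReducedFace : Reduced → Bool
      isReducedFace (l , z , c) = isFaceᵇ (n ∸ 1) (reducedSize l i) (members z) ∧ admissible l z c

      reduce-face : ∀ t → isFaceₙ t ≡ true → isReducedFace (reduce t) ≡ true
      reduce-face (x , y) face with isFaceᵇ⇒IsFace face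
      ... | F , size≡ = cong₂ _∧_ (IsFace⇒isFaceᵇ z-face (+bit≡suc⇒ l (trans (sym size-relation) size≡))) c-admissible
        where open Forward x y F

      rebuild-reduce : ∀ t → isFaceₙ t ≡ true → rebuild (reduce t) ≡ t
      rebuild-reduce (x , y) face = cong₂ _,_
        (family-unique _ x (λ T → sym (proj₁ (decomposition T (T ≟ₛ c)))))
        (family-unique _ y (λ T → sym (proj₂ (decomposition T (T ≟ₛ c)))))
        where open Forward x y (proj₁ (isFaceᵇ⇒IsFace face))

      rebuild-face : ∀ r → isReducedFace r ≡ true → isFaceₙ (rebuild r) ≡ true
      rebuild-face (l , z , c) r-face with ∧-true⁻ r-face
      ... | z-face , adm with isFaceᵇ⇒IsFace z-face
      ...   | Fz , size≡ = IsFace⇒isFaceᵇ xy-face (trans size-relation (⇒+bit≡suc l size≡))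
        where open Backward l z c Fz adm

      reduce-rebuild : ∀ r → isReducedFace r ≡ true → reduce (rebuild r) ≡ r
      reduce-rebuild (l , z , c) r-face with ∧-true⁻ r-face
      ... | z-face , adm = cong₂ _,_ lost-xy (cong₂ _,_ restrict-xy anchor-xy)
        where open Backward l z c (proj₁ (isFaceᵇ⇒IsFace z-face)) adm

      reduced-count : ∀ l → count (λ zc → isReducedFace (l , zc)) (cartesianProduct (families K) U)
                          ≡ countFaces (n ∸ 1) (reducedSize l i) * (reducedSize l i + (bit l * K + 1))
      reduced-count l = begin
        count (λ zc → isReducedFace (l , zc)) (cartesianProduct (families K) U)
          ≡⟨ count-cartesianProduct-∧ (isFaceᵇ (n ∸ 1) j ∘ members) (admissible l) _ (families K) U admissible-count′ ⟩
        count (isFaceᵇ (n ∸ 1) j ∘ members) (families K) * (j + (bit l * K + 1))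
          ≡⟨ cong (_* (j + (bit l * K + 1))) (countFaces≡count-families (n ∸ 1) j) ⟨
        countFaces (n ∸ 1) j * (j + (bit l * K + 1)) ∎
        where
        open ≡-Reasoning
        j = reducedSize l i
        admissible-count′ : ∀ z → isFaceᵇ (n ∸ 1) j (members z) ≡ true → count (admissible l z) U ≡ j + (bit l * K + 1)
        admissible-count′ z z-face with isFaceᵇ⇒IsFace z-face
        ... | Fz , size≡ = trans (admissible-count l z Fz) (cong (_+ _) size≡)

      countFaces-suc : countFaces n (suc i) ≡ (i + 2) * countFaces (n ∸ 1) (suc i) + (n + i ∸ 1) * countFaces (n ∸ 1) i
      countFaces-suc = begin
        countFaces n (suc i)
          ≡⟨ countFaces≡count-families n (suc i) ⟩
        count isFaceₙ (families (suc K))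
          ≡⟨ count-bijection (families-enumerates (suc K)) reductions-enumerate
               isFaceₙ isReducedFace reduce rebuild reduce-face rebuild-reduce rebuild-face reduce-rebuild ⟩
        count isReducedFace reductions
          ≡⟨ sumBy-cartesianProduct _ (true ∷ false ∷ []) (cartesianProduct (families K) U) ⟩
        _ ≡⟨ cong₂ (λ a b → a + (b + 0)) (reduced-count true) (reduced-count false) ⟩
        countFaces (n ∸ 1) i * (i + (1 * K + 1)) + (countFaces (n ∸ 1) (suc i) * (suc i + (0 * K + 1)) + 0)
          ≡⟨ arithmetic (countFaces (n ∸ 1) i) (countFaces (n ∸ 1) (suc i)) i m′ ⟩
        (i + 2) * countFaces (n ∸ 1) (suc i) + (n + i ∸ 1) * countFaces (n ∸ 1) i ∎
        where
        open ≡-Reasoning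
        arithmetic : ∀ a b j m → a * (j + (1 * suc (suc m) + 1)) + (b * (suc j + (0 * suc (suc m) + 1)) + 0)
                               ≡ (j + 2) * b + suc (suc (suc (m + j))) * a
        arithmetic = solve-∀


open FaceCounting using (countFaces-zero; module Recurrence)
open import Data.Integer using (ℤ; +_; -_; _+_; _-_; _*_) renaming (_≤_ to _≤ℤ_)
open import Data.Integer using (-[1+_]; -≤-)
open import Data.Nat using (zero; suc; z≤n; s≤s)
import Data.Nat as ℕ
open import Data.Integer.Properties using (pos-+; pos-*; *-zeroʳ)
open import Relation.Binary.PropositionalEquality using (refl; trans; cong; cong₂)
open import Data.Product using (_,_)

theorem3p3 : (n : ℕ) → 4 ≤ n →
    ((i : ℤ) → - + 1 ≤ℤ i → i ≤ℤ + n - + 4 →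
      + f n i ≡ (i + + 2) * + f (n ∸ 1) i + (+ n + i - + 1) * + f (n ∸ 1) (i - + 1))
    × f n (- + 1) ≡ 1
theorem3p3 .(suc (suc (suc (suc m′)))) (s≤s (s≤s (s≤s (s≤s {n = m′} z≤n)))) = recurrence , countFaces-zero n
  where
  open Recurrence m′ using (n; countFaces-suc)

  pos-*-+ : ∀ a b c d → + (a ℕ.* b ℕ.+ c ℕ.* d) ≡ + a * + b + + c * + d
  pos-*-+ a b c d = trans (pos-+ (a ℕ.* b) (c ℕ.* d)) (cong₂ _+_ (pos-* a b) (pos-* c d))

  f-pred : ∀ k → f (n ∸ 1) (+ k - + 1) ≡ countFaces (n ∸ 1) k
  f-pred zero    = refl
  f-pred (suc k) = refl

  recurrence : (i : ℤ) → - + 1 ≤ℤ i → i ≤ℤ + n - + 4 →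
               + f n i ≡ (i + + 2) * + f (n ∸ 1) i + (+ n + i - + 1) * + f (n ∸ 1) (i - + 1)
  recurrence (+ k) _ _ rewrite f-pred k = trans (cong +_ (countFaces-suc k))
    (pos-*-+ (k ℕ.+ 2) (countFaces (n ∸ 1) (suc k)) (n ℕ.+ k ∸ 1) (countFaces (n ∸ 1) k))
  recurrence -[1+ zero ] _ _
    rewrite countFaces-zero n | countFaces-zero (n ∸ 1) | *-zeroʳ (+ n + -[1+ zero ] - + 1) = refl
  recurrence -[1+ suc _ ] (-≤- ()) _
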